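{- Let $f:\{0,1\}^n\to\{0,1\}$ have degree $d=\deg(f)$, and let $M\subseteq[n]$ with $|M|=d$ be such that the monomial $\prod_{i\in M}x_i$ has non-zero coefficient in the multilinear polynomial of $f$. Then for every assignment $\alpha\in\{0,1\}^M$ to the variables in $M$, the restricted function $f_\alpha$ (on the variables $[n]\setminus M$) satisfies $\mathrm{bs}(f_\alpha)\le\mathrm{bs}(f)-1$.
   Context: $\deg(f)$ is the degree of the unique multilinear real polynomial agreeing with $f$ on $\{0,1\}^n$. For $S\subseteq[n]$, $x^S$ is $x$ with bits in $S$ flipped. $\mathrm{bs}_x(f)$ is the maximum $k$ such that there exist pairwise disjoint $B_1,\dots,B_k$ with $f(x)\ne f(x^{B_i})$ for all $i$; $\mathrm{bs}(f)=\max_x\mathrm{bs}_x(f)$. -}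

module Defs where

open import Data.Bool using (Bool; true; false; if_then_else_; _xor_)
open import Data.Nat using (ℕ; zero; suc; _≤_)
open import Data.Integer using (ℤ; _+_; _*_; 0ℤ; 1ℤ)
open import Data.Fin using (Fin; zero; suc)
open import Data.Fin.Subset using (Subset; _∈_; _∉_; ∣_∣)
open import Data.Fin.Subset.Properties using (_∈?_)
open import Data.Vec using (Vec; []; _∷_)
open import Data.List using (List; []; _∷_; map; _++_; foldr)
open import Data.Product using (Σ; _×_; _,_)
open import Relation.Binary.PropositionalEquality using (_≡_; _≢_)
open import Relation.Nullary using (yes; no)

flip : {I : Set} → (I → Bool) → (I → Bool) → (I → Bool)
flip x B i = x i xor B i

PairwiseDisjoint : {I : Set} {k : ℕ} → (Fin k → I → Bool) → Set
PairwiseDisjoint {I} {k} B =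
  (a b : Fin k) → a ≢ b → (v : I) → B a v ≡ true → B b v ≡ false

HasSensitiveBlocks : {I : Set} → ((I → Bool) → Bool) → (I → Bool) → ℕ → Set
HasSensitiveBlocks {I} f x k =
  Σ (Fin k → I → Bool) λ B →
    PairwiseDisjoint B × ((a : Fin k) → f (flip x (B a)) ≢ f x)

IsBlockSensitivity : {I : Set} → ((I → Bool) → Bool) → ℕ → Set
IsBlockSensitivity {I} f b =
  Σ (I → Bool) (λ x → HasSensitiveBlocks f x b)
  × ((x : I → Bool) (k : ℕ) → HasSensitiveBlocks f x k → k ≤ b)

-- Multilinear polynomials in n variables: coefficient map Subset n → ℤ.

allSubsets : (n : ℕ) → List (Subset n)
allSubsets zero = [] ∷ []
allSubsets (suc n) = map (true ∷_) (allSubsets n) ++ map (false ∷_) (allSubsets n)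

bit : Bool → ℤ
bit b = if b then 1ℤ else 0ℤ

monomial : {n : ℕ} → Subset n → (Fin n → Bool) → ℤ
monomial [] x = 1ℤ
monomial (s ∷ S) x = (if s then bit (x zero) else 1ℤ) * monomial S (λ i → x (suc i))

evalPoly : {n : ℕ} → (Subset n → ℤ) → (Fin n → Bool) → ℤ
evalPoly {n} p x = foldr (λ S acc → p S * monomial S x + acc) 0ℤ (allSubsets n)

Represents : {n : ℕ} → (Subset n → ℤ) → ((Fin n → Bool) → Bool) → Set
Represents p f = ∀ x → evalPoly p x ≡ bit (f x)

IsDegree : {n : ℕ} → (Subset n → ℤ) → ℕ → Set
IsDegree p d =
  ((S : Subset _) → p S ≢ 0ℤ → ∣ S ∣ ≤ d)
  × Σ (Subset _) (λ S → (p S ≢ 0ℤ) × (∣ S ∣ ≡ d))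

InM : {n : ℕ} → Subset n → Set
InM {n} M = Σ (Fin n) (λ i → i ∈ M)

OutM : {n : ℕ} → Subset n → Set
OutM {n} M = Σ (Fin n) (λ i → i ∉ M)

restrict : {n : ℕ} → ((Fin n → Bool) → Bool) → (M : Subset n) →
           (InM M → Bool) → (OutM M → Bool) → Bool
restrict f M α y = f combined
  where
  combined : _ → Bool
  combined i with i ∈? M
  ... | yes i∈M = α (i , i∈M)
  ... | no  i∉M = y (i , i∉M)

-- Let Δ_M g (y) = Σ_{z ∈ {0,1}^M} (-1)^{|M|-|z|} g(y[M ↦ z]) be the M-th finite difference. It kills
-- every monomial x^S with M ⊈ S and sends x^M to 1, so when M has maximal degree in the polynomial p
-- of f, Δ_M f is the non-zero constant p(M). For M ≠ ∅ the difference of a constant is 0, so every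
-- subcube {x | x agrees with x₀ outside M} contains a point x₁ with f(x₁) ≠ f(x₀). The block x₀ ⊕ x₁
-- lies inside M, hence is disjoint from the sensitive blocks of f_α at x₀ (which avoid M), and so
-- bs(f) ≥ bs(f_α) + 1. For M = ∅, f is constant and bs(f_α) = 0.
module Submission where

open import Defs
open import Data.Bool using (Bool; true; false; if_then_else_; _xor_)
open import Data.Bool.Properties using (xor-same; xor-assoc; xor-identityʳ)
open import Data.Nat using (ℕ; zero; suc; _≤_; _∸_; z≤n; s≤s)
open import Data.Nat.Properties using (≤-trans; <-irrefl)
open import Data.Integer using (ℤ; 0ℤ; 1ℤ; _+_; _*_; _-_; _≟_)
import Data.Integer.Properties as ℤ
open import Data.Integer.Tactic.RingSolver using (solve-∀)
open import Data.Fin using (Fin; zero; suc)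
open import Data.Fin.Subset using (Subset; _∈_; _∉_; _⊆_; ∣_∣; inside; outside; Empty)
open import Data.Fin.Subset.Properties
  using (_∈?_; _⊆?_; nonempty?; s⊆s; out⊆; drop-∷-⊆; p⊆q⇒∣p∣≤∣q∣)
open import Data.Vec using ([]; _∷_; here; there)
open import Data.Vec.Properties using (∷-injectiveʳ)
open import Data.Vec.Functional using (head; tail) renaming (_∷_ to _◂_)
open import Data.List using (List; []; _∷_; map; _++_; foldr)
open import Data.List.Properties using (foldr-map)
open import Data.Product using (∃; _×_; _,_)
open import Data.Empty using (⊥-elim)
open import Function using (_∘_; const)
open import Relation.Nullary using (¬_; yes; no)
open import Relation.Nullary.Decidable using (decidable-stable)
open import Relation.Binary.PropositionalEquality
  using (_≡_; _≢_; _≗_; refl; sym; trans; cong; cong₂; subst; module ≡-Reasoning)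

private
  variable
    n k : ℕ

Δ : Subset n → ((Fin n → Bool) → ℤ) → (Fin n → Bool) → ℤ
Δ []            g y = g y
Δ (inside  ∷ M) g y = Δ M (g ∘ (true ◂_)) (tail y) - Δ M (g ∘ (false ◂_)) (tail y)
Δ (outside ∷ M) g y = Δ M (g ∘ (head y ◂_)) (tail y)

Δ-cong : (M : Subset n) {g h : (Fin n → Bool) → ℤ} {y : Fin n → Bool} →
         g ≗ h → Δ M g y ≡ Δ M h y
Δ-cong []            g≗h = g≗h _
Δ-cong (inside  ∷ M) g≗h = cong₂ _-_ (Δ-cong M (g≗h ∘ _)) (Δ-cong M (g≗h ∘ _))
Δ-cong (outside ∷ M) g≗h = Δ-cong M (g≗h ∘ _)

Δ-+ : (M : Subset n) (g h : (Fin n → Bool) → ℤ) (y : Fin n → Bool) →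
      Δ M (λ x → g x + h x) y ≡ Δ M g y + Δ M h y
Δ-+ []            g h y = refl
Δ-+ (inside  ∷ M) g h y =
  trans (cong₂ _-_ (Δ-+ M (g ∘ (true ◂_)) (h ∘ (true ◂_)) (tail y))
                   (Δ-+ M (g ∘ (false ◂_)) (h ∘ (false ◂_)) (tail y)))
        (interchange (Δ₁ g) (Δ₁ h) (Δ₀ g) (Δ₀ h))
  where
  Δ₁ Δ₀ : ((Fin _ → Bool) → ℤ) → ℤ
  Δ₁ u = Δ M (u ∘ (true ◂_)) (tail y)
  Δ₀ u = Δ M (u ∘ (false ◂_)) (tail y)
  interchange : ∀ a b c e → (a + b) - (c + e) ≡ (a - c) + (b - e)
  interchange = solve-∀
Δ-+ (outside ∷ M) g h y = Δ-+ M (g ∘ (head y ◂_)) (h ∘ (head y ◂_)) (tail y)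

Δ-*ˡ : (M : Subset n) (c : ℤ) (g : (Fin n → Bool) → ℤ) (y : Fin n → Bool) →
       Δ M (λ x → c * g x) y ≡ c * Δ M g y
Δ-*ˡ []            c g y = refl
Δ-*ˡ (inside  ∷ M) c g y =
  trans (cong₂ _-_ (Δ-*ˡ M c (g ∘ (true ◂_)) (tail y)) (Δ-*ˡ M c (g ∘ (false ◂_)) (tail y)))
        (factor c (Δ M (g ∘ (true ◂_)) (tail y)) (Δ M (g ∘ (false ◂_)) (tail y)))
  where
  factor : ∀ c a b → c * a - c * b ≡ c * (a - b)
  factor = solve-∀
Δ-*ˡ (outside ∷ M) c g y = Δ-*ˡ M c (g ∘ (head y ◂_)) (tail y)

-- 0ℤ * i reduces to 0ℤ, so this is the case c = 0ℤ of Δ-*ˡ.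
Δ-0 : (M : Subset n) (y : Fin n → Bool) → Δ M (const 0ℤ) y ≡ 0ℤ
Δ-0 M y = Δ-*ˡ M 0ℤ (const 0ℤ) y

Δ-const : {M : Subset n} {i : Fin n} (c : ℤ) (y : Fin n → Bool) →
          i ∈ M → Δ M (const c) y ≡ 0ℤ
Δ-const {M = inside  ∷ M} c y here        = ℤ.+-inverseʳ (Δ M (const c) (tail y))
Δ-const {M = inside  ∷ M} c y (there i∈M) =
  cong₂ _-_ (Δ-const c (tail y) i∈M) (Δ-const c (tail y) i∈M)
Δ-const {M = outside ∷ M} c y (there i∈M) = Δ-const c (tail y) i∈M

Δ-∅ : {M : Subset n} {g : (Fin n → Bool) → ℤ} (y : Fin n → Bool) →
      Empty M → (∀ {x x′} → x ≗ x′ → g x ≡ g x′) → Δ M g y ≡ g y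
Δ-∅ {M = []}          y _     _      = refl
Δ-∅ {M = inside  ∷ M} y M-∅   _      = ⊥-elim (M-∅ (zero , here))
Δ-∅ {M = outside ∷ M} y M-∅   g-cong =
  trans (Δ-∅ (tail y) (λ (i , i∈M) → M-∅ (suc i , there i∈M)) (g-cong ∘ ◂-cong))
        (g-cong λ { zero → refl ; (suc i) → refl })
  where
  ◂-cong : {x x′ : Fin _ → Bool} → x ≗ x′ → (head y ◂ x) ≗ (head y ◂ x′)
  ◂-cong x≗x′ zero    = refl
  ◂-cong x≗x′ (suc i) = x≗x′ i

sumOver : {A : Set} → (A → ℤ) → List A → ℤ
sumOver h = foldr (λ S acc → h S + acc) 0ℤ

sumOver-cong : {A : Set} {h h′ : A → ℤ} (L : List A) → h ≗ h′ → sumOver h L ≡ sumOver h′ L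
sumOver-cong []      h≗h′ = refl
sumOver-cong (S ∷ L) h≗h′ = cong₂ _+_ (h≗h′ S) (sumOver-cong L h≗h′)

sumOver-0 : {A : Set} {h : A → ℤ} (L : List A) → (∀ S → h S ≡ 0ℤ) → sumOver h L ≡ 0ℤ
sumOver-0 []      h≡0 = refl
sumOver-0 (S ∷ L) h≡0 = cong₂ _+_ (h≡0 S) (sumOver-0 L h≡0)

sumOver-++ : {A : Set} (h : A → ℤ) (L L′ : List A) →
             sumOver h (L ++ L′) ≡ sumOver h L + sumOver h L′
sumOver-++ h []      L′ = sym (ℤ.+-identityˡ _)
sumOver-++ h (S ∷ L) L′ = trans (cong (h S +_) (sumOver-++ h L L′)) (sym (ℤ.+-assoc (h S) _ _))

sumOver-allSubsets : (h : Subset (suc n) → ℤ) →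
  sumOver h (allSubsets (suc n)) ≡
  sumOver (h ∘ (inside ∷_)) (allSubsets n) + sumOver (h ∘ (outside ∷_)) (allSubsets n)
sumOver-allSubsets {n} h =
  trans (sumOver-++ h (map (inside ∷_) (allSubsets n)) (map (outside ∷_) (allSubsets n)))
        (cong₂ _+_ (foldr-map _ (inside ∷_) 0ℤ (allSubsets n))
                   (foldr-map _ (outside ∷_) 0ℤ (allSubsets n)))

sumOver-allSubsets-single : {h : Subset n → ℤ} (M : Subset n) →
  (∀ S → S ≢ M → h S ≡ 0ℤ) → sumOver h (allSubsets n) ≡ h M
sumOver-allSubsets-single {zero}  []            _   = ℤ.+-identityʳ _
sumOver-allSubsets-single {suc n} {h} (inside ∷ M) off-M = begin
  sumOver h (allSubsets (suc n))
    ≡⟨ sumOver-allSubsets h ⟩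
  sumOver (h ∘ (inside ∷_)) (allSubsets n) + sumOver (h ∘ (outside ∷_)) (allSubsets n)
    ≡⟨ cong₂ _+_ (sumOver-allSubsets-single M (λ S S≢M → off-M _ (S≢M ∘ ∷-injectiveʳ)))
                 (sumOver-0 (allSubsets n) (λ S → off-M _ λ ())) ⟩
  h (inside ∷ M) + 0ℤ
    ≡⟨ ℤ.+-identityʳ _ ⟩
  h (inside ∷ M) ∎
  where open ≡-Reasoning
sumOver-allSubsets-single {suc n} {h} (outside ∷ M) off-M = begin
  sumOver h (allSubsets (suc n))
    ≡⟨ sumOver-allSubsets h ⟩
  sumOver (h ∘ (inside ∷_)) (allSubsets n) + sumOver (h ∘ (outside ∷_)) (allSubsets n)
    ≡⟨ cong₂ _+_ (sumOver-0 (allSubsets n) (λ S → off-M _ λ ()))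
                 (sumOver-allSubsets-single M (λ S S≢M → off-M _ (S≢M ∘ ∷-injectiveʳ))) ⟩
  0ℤ + h (outside ∷ M)
    ≡⟨ ℤ.+-identityˡ _ ⟩
  h (outside ∷ M) ∎
  where open ≡-Reasoning

Δ-sumOver : {A : Set} (M : Subset n) (c : A → ℤ) (G : A → (Fin n → Bool) → ℤ)
            (y : Fin n → Bool) (L : List A) →
            Δ M (λ x → sumOver (λ S → c S * G S x) L) y ≡ sumOver (λ S → c S * Δ M (G S) y) L
Δ-sumOver M c G y []      = Δ-0 M y
Δ-sumOver M c G y (S ∷ L) =
  trans (Δ-+ M (λ x → c S * G S x) (λ x → sumOver (λ S → c S * G S x) L) y)
        (cong₂ _+_ (Δ-*ˡ M (c S) (G S) y) (Δ-sumOver M c G y L))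

monomial-cong : (S : Subset n) {x x′ : Fin n → Bool} → x ≗ x′ → monomial S x ≡ monomial S x′
monomial-cong []      x≗x′ = refl
monomial-cong (s ∷ S) x≗x′ =
  cong₂ _*_ (cong (λ b → if s then bit b else 1ℤ) (x≗x′ zero)) (monomial-cong S (x≗x′ ∘ suc))

evalPoly-cong : (p : Subset n → ℤ) {x x′ : Fin n → Bool} → x ≗ x′ → evalPoly p x ≡ evalPoly p x′
evalPoly-cong {n} p x≗x′ = sumOver-cong (allSubsets n) (λ S → cong (p S *_) (monomial-cong S x≗x′))

Δ-monomial-⊈ : {M S : Subset n} (y : Fin n → Bool) → ¬ (M ⊆ S) → Δ M (monomial S) y ≡ 0ℤ
Δ-monomial-⊈ {M = []}          {[]}          y M⊈S = ⊥-elim (M⊈S λ ())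
Δ-monomial-⊈ {M = inside  ∷ M} {inside  ∷ S} y M⊈S =
  cong₂ _-_ (trans (Δ-cong M (λ z → ℤ.*-identityˡ _)) (Δ-monomial-⊈ (tail y) (M⊈S ∘ s⊆s)))
            (Δ-0 M (tail y))
Δ-monomial-⊈ {M = inside  ∷ M} {outside ∷ S} y M⊈S =
  ℤ.+-inverseʳ (Δ M (λ z → 1ℤ * monomial S z) (tail y))
Δ-monomial-⊈ {M = outside ∷ M} {s ∷ S}       y M⊈S =
  trans (Δ-*ˡ M c (monomial S) (tail y))
        (trans (cong (c *_) (Δ-monomial-⊈ (tail y) (M⊈S ∘ out⊆))) (ℤ.*-zeroʳ c))
  where c = if s then bit (head y) else 1ℤ

Δ-monomial-self : (M : Subset n) (y : Fin n → Bool) → Δ M (monomial M) y ≡ 1ℤ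
Δ-monomial-self []            y = refl
Δ-monomial-self (inside  ∷ M) y =
  cong₂ _-_ (trans (Δ-cong M (λ z → ℤ.*-identityˡ _)) (Δ-monomial-self M (tail y)))
            (Δ-0 M (tail y))
Δ-monomial-self (outside ∷ M) y =
  trans (Δ-cong M (λ z → ℤ.*-identityˡ _)) (Δ-monomial-self M (tail y))

p⊆q⇒∣q∣≤∣p∣⇒p≡q : {p q : Subset n} → p ⊆ q → ∣ q ∣ ≤ ∣ p ∣ → p ≡ q
p⊆q⇒∣q∣≤∣p∣⇒p≡q {p = []}          {[]}          _   _ = refl
p⊆q⇒∣q∣≤∣p∣⇒p≡q {p = inside  ∷ p} {inside  ∷ q} p⊆q (s≤s q≤p) =
  cong (inside ∷_) (p⊆q⇒∣q∣≤∣p∣⇒p≡q (drop-∷-⊆ p⊆q) q≤p)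
p⊆q⇒∣q∣≤∣p∣⇒p≡q {p = inside  ∷ p} {outside ∷ q} p⊆q _ with p⊆q here
... | ()
p⊆q⇒∣q∣≤∣p∣⇒p≡q {p = outside ∷ p} {inside  ∷ q} p⊆q q<p =
  ⊥-elim (<-irrefl refl (≤-trans q<p (p⊆q⇒∣p∣≤∣q∣ (drop-∷-⊆ p⊆q))))
p⊆q⇒∣q∣≤∣p∣⇒p≡q {p = outside ∷ p} {outside ∷ q} p⊆q q≤p =
  cong (outside ∷_) (p⊆q⇒∣q∣≤∣p∣⇒p≡q (drop-∷-⊆ p⊆q) q≤p)

Δ-evalPoly-top : {p : Subset n → ℤ} (M : Subset n) → (∀ S → p S ≢ 0ℤ → ∣ S ∣ ≤ ∣ M ∣) →
                 (y : Fin n → Bool) → Δ M (evalPoly p) y ≡ p M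
Δ-evalPoly-top {n} {p} M deg≤∣M∣ y = begin
  Δ M (evalPoly p) y                                     ≡⟨ Δ-sumOver M p monomial y (allSubsets n) ⟩
  sumOver (λ S → p S * Δ M (monomial S) y) (allSubsets n) ≡⟨ sumOver-allSubsets-single M off-M ⟩
  p M * Δ M (monomial M) y                                ≡⟨ cong (p M *_) (Δ-monomial-self M y) ⟩
  p M * 1ℤ                                                ≡⟨ ℤ.*-identityʳ (p M) ⟩
  p M                                                     ∎
  where
  open ≡-Reasoning
  off-M : ∀ S → S ≢ M → p S * Δ M (monomial S) y ≡ 0ℤ
  off-M S S≢M with M ⊆? S
  ... | no  M⊈S = trans (cong (p S *_) (Δ-monomial-⊈ y M⊈S)) (ℤ.*-zeroʳ (p S))
  ... | yes M⊆S = cong (_* Δ M (monomial S) y) pS≡0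
    where
    pS≡0 : p S ≡ 0ℤ
    pS≡0 = decidable-stable (p S ≟ 0ℤ)
             (λ pS≢0 → S≢M (sym (p⊆q⇒∣q∣≤∣p∣⇒p≡q M⊆S (deg≤∣M∣ S pS≢0))))

AgreeOutside : Subset n → (Fin n → Bool) → (Fin n → Bool) → Set
AgreeOutside {n} M y x = (i : Fin n) → i ∉ M → x i ≡ y i

◂-witness : {s : Bool} {M : Subset n} {g : (Fin (suc n) → Bool) → ℤ} {y : Fin (suc n) → Bool}
            {c : ℤ} (b : Bool) → (zero ∉ s ∷ M → b ≡ head y) →
            ∃ (λ x → AgreeOutside M (tail y) x × g (b ◂ x) ≢ c) →
            ∃ (λ x → AgreeOutside (s ∷ M) y x × g x ≢ c)
◂-witness b b≡y₀ (x , agree , gx≢c) = b ◂ x , ◂-agree , gx≢c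
  where
  ◂-agree : AgreeOutside _ _ (b ◂ x)
  ◂-agree zero    0∉M = b≡y₀ 0∉M
  ◂-agree (suc i) i∉M = agree i (i∉M ∘ there)

Δ≢Δ-const⇒witness : (M : Subset n) (g : (Fin n → Bool) → ℤ) (y : Fin n → Bool) (c : ℤ) →
  Δ M g y ≢ Δ M (const c) y → ∃ λ x → AgreeOutside M y x × g x ≢ c
Δ≢Δ-const⇒witness []            g y c gy≢c = y , (λ _ _ → refl) , gy≢c
Δ≢Δ-const⇒witness (inside  ∷ M) g y c Δg≢Δc
  with Δ M (g ∘ (true ◂_)) (tail y) ≟ Δ M (const c) (tail y)
     | Δ M (g ∘ (false ◂_)) (tail y) ≟ Δ M (const c) (tail y)
... | no  Δg₁≢Δc | _ =
  ◂-witness true (λ 0∉M → ⊥-elim (0∉M here)) (Δ≢Δ-const⇒witness M _ (tail y) c Δg₁≢Δc)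
... | yes _ | no Δg₀≢Δc =
  ◂-witness false (λ 0∉M → ⊥-elim (0∉M here)) (Δ≢Δ-const⇒witness M _ (tail y) c Δg₀≢Δc)
... | yes Δg₁≡Δc | yes Δg₀≡Δc = ⊥-elim (Δg≢Δc (cong₂ _-_ Δg₁≡Δc Δg₀≡Δc))
Δ≢Δ-const⇒witness (outside ∷ M) g y c Δg≢Δc =
  ◂-witness (head y) (λ _ → refl) (Δ≢Δ-const⇒witness M _ (tail y) c Δg≢Δc)

-- restrict f M α y reduces to f (merge M α y).
merge : (M : Subset n) → (InM M → Bool) → (OutM M → Bool) → Fin n → Bool
merge M α y i = restrict (λ x → x i) M α y

liftBlock : (M : Subset n) → (OutM M → Bool) → Fin n → Bool
liftBlock M B i with i ∈? M
... | yes _   = false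
... | no  i∉M = B (i , i∉M)

flip-merge : (M : Subset n) (α : InM M → Bool) (y B : OutM M → Bool) →
             flip (merge M α y) (liftBlock M B) ≗ merge M α (flip y B)
flip-merge M α y B i with i ∈? M
... | yes _ = xor-identityʳ _
... | no  _ = refl

liftBlock-∈ : (M : Subset n) (B : OutM M → Bool) {i : Fin n} → i ∈ M → liftBlock M B i ≡ false
liftBlock-∈ M B {i} i∈M with i ∈? M
... | yes _   = refl
... | no  i∉M = ⊥-elim (i∉M i∈M)

liftBlock-true⇒∉ : (M : Subset n) (B : OutM M → Bool) {i : Fin n} → liftBlock M B i ≡ true → i ∉ M
liftBlock-true⇒∉ M B {i} Bi≡true with i ∈? M
... | no i∉M = i∉M

liftBlock-disjoint : (M : Subset n) {B B′ : OutM M → Bool} → (∀ w → B w ≡ true → B′ w ≡ false) →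
                     (i : Fin n) → liftBlock M B i ≡ true → liftBlock M B′ i ≡ false
liftBlock-disjoint M B-disj i Bi≡true with i ∈? M
... | yes _   = refl
... | no  i∉M = B-disj (i , i∉M) Bi≡true

agreeOutside-xor : {M : Subset n} {y x : Fin n → Bool} {i : Fin n} →
                   AgreeOutside M y x → i ∉ M → y i xor x i ≡ false
agreeOutside-xor {y = y} {i = i} agree i∉M = trans (cong (y i xor_) (agree i i∉M)) (xor-same (y i))

agreeOutside-xor-true⇒∈ : {M : Subset n} {y x : Fin n → Bool} {i : Fin n} →
                          AgreeOutside M y x → y i xor x i ≡ true → i ∈ M
agreeOutside-xor-true⇒∈ {M = M} {i = i} agree yx≡true with i ∈? M
... | yes i∈M = i∈M
... | no  i∉M with trans (sym yx≡true) (agreeOutside-xor agree i∉M)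
...   | ()

sensitiveBlocks-extend :
  {f : (Fin n → Bool) → Bool} → (∀ {x x′} → x ≗ x′ → f x ≡ f x′) →
  (M : Subset n) (α : InM M → Bool) (y : OutM M → Bool) (x₁ : Fin n → Bool) →
  AgreeOutside M (merge M α y) x₁ → f x₁ ≢ f (merge M α y) →
  HasSensitiveBlocks (restrict f M α) y k → HasSensitiveBlocks f (merge M α y) (suc k)
sensitiveBlocks-extend {n} {k} {f} f-cong M α y x₁ agree fx₁≢fx₀ (B , B-disjoint , B-sensitive) =
  blocks , disjoint , sensitive
  where
  x₀ : Fin n → Bool
  x₀ = merge M α y

  blocks : Fin (suc k) → Fin n → Bool
  blocks zero    i = x₀ i xor x₁ i
  blocks (suc a)   = liftBlock M (B a)

  flip-difference : flip x₀ (blocks zero) ≗ x₁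
  flip-difference i = trans (sym (xor-assoc (x₀ i) (x₀ i) (x₁ i))) (cong (_xor x₁ i) (xor-same (x₀ i)))

  sensitive : (a : Fin (suc k)) → f (flip x₀ (blocks a)) ≢ f x₀
  sensitive zero    e = fx₁≢fx₀ (trans (sym (f-cong flip-difference)) e)
  sensitive (suc a) e = B-sensitive a (trans (sym (f-cong (flip-merge M α y (B a)))) e)

  disjoint : PairwiseDisjoint blocks
  disjoint zero    zero    0≢0 = ⊥-elim (0≢0 refl)
  disjoint zero    (suc b) _   i = liftBlock-∈ M (B b) ∘ agreeOutside-xor-true⇒∈ {i = i} agree
  disjoint (suc a) zero    _   i = agreeOutside-xor {i = i} agree ∘ liftBlock-true⇒∉ M (B a)
  disjoint (suc a) (suc b) a≢b = liftBlock-disjoint M (B-disjoint a b (a≢b ∘ cong suc))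

sensitiveBlocks-of-constant : {I : Set} {f : (I → Bool) → Bool} {x : I → Bool} →
  (∀ x x′ → f x ≡ f x′) → HasSensitiveBlocks f x k → k ≡ 0
sensitiveBlocks-of-constant {k = zero}  f-constant _ = refl
sensitiveBlocks-of-constant {k = suc k} f-constant (_ , _ , sensitive) =
  ⊥-elim (sensitive zero (f-constant _ _))

bit-injective : {a b : Bool} → bit a ≡ bit b → a ≡ b
bit-injective {false} {false} _ = refl
bit-injective {true}  {true}  _ = refl

represented-cong : {p : Subset n → ℤ} {f : (Fin n → Bool) → Bool} → Represents p f →
                   ∀ {x x′} → x ≗ x′ → f x ≡ f x′
represented-cong {p = p} rep {x} {x′} x≗x′ =
  bit-injective (trans (sym (rep x)) (trans (evalPoly-cong p x≗x′) (rep x′)))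

Δ-represented-top : {p : Subset n → ℤ} {f : (Fin n → Bool) → Bool} (M : Subset n) →
  Represents p f → (∀ S → p S ≢ 0ℤ → ∣ S ∣ ≤ ∣ M ∣) →
  (y : Fin n → Bool) → Δ M (bit ∘ f) y ≡ p M
Δ-represented-top {p = p} M rep deg≤∣M∣ y =
  trans (Δ-cong M (sym ∘ rep)) (Δ-evalPoly-top {p = p} M deg≤∣M∣ y)

m<n⇒m≤n∸1 : {m n : ℕ} → suc m ≤ n → m ≤ n ∸ 1
m<n⇒m≤n∸1 (s≤s m≤n) = m≤n

lemma3 : (n : ℕ) (f : (Fin n → Bool) → Bool) (p : Subset n → ℤ) (d : ℕ) →
    Represents p f → IsDegree p d →
    (M : Subset n) → ∣ M ∣ ≡ d → p M ≢ 0ℤ →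
    (α : InM M → Bool) (b bα : ℕ) →
    IsBlockSensitivity f b →
    IsBlockSensitivity (restrict f M α) bα →
    bα ≤ b ∸ 1
lemma3 n f p .(∣ M ∣) rep (deg≤∣M∣ , _) M refl pM≢0 α b bα (_ , bs-maximal) ((y , B) , _)
  with nonempty? M
... | no M-empty = subst (_≤ b ∸ 1) (sym (sensitiveBlocks-of-constant fα-constant B)) z≤n
  where
  bit-f≡pM : ∀ x → bit (f x) ≡ p M
  bit-f≡pM x = trans (sym (Δ-∅ x M-empty (cong bit ∘ represented-cong {p = p} rep)))
                     (Δ-represented-top {p = p} M rep deg≤∣M∣ x)
  fα-constant : ∀ y y′ → restrict f M α y ≡ restrict f M α y′
  fα-constant _ _ = bit-injective (trans (bit-f≡pM _) (sym (bit-f≡pM _)))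
... | yes (i , i∈M) =
  let (x₁ , agree , bit-fx₁≢bit-fx₀) = Δ≢Δ-const⇒witness M (bit ∘ f) x₀ (bit (f x₀)) Δf≢Δconst
  in m<n⇒m≤n∸1 (bs-maximal x₀ (suc bα)
       (sensitiveBlocks-extend (represented-cong {p = p} rep) M α y x₁ agree (bit-fx₁≢bit-fx₀ ∘ cong bit) B))
  where
  x₀ : Fin n → Bool
  x₀ = merge M α y
  Δf≢Δconst : Δ M (bit ∘ f) x₀ ≢ Δ M (const (bit (f x₀))) x₀
  Δf≢Δconst e = pM≢0 (trans (sym (Δ-represented-top {p = p} M rep deg≤∣M∣ x₀))
                            (trans e (Δ-const (bit (f x₀)) x₀ i∈M)))
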